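{- Let $\lambda$ be a real number and let $\{a_n\}_{n\ge0}$, $\{A_n\}_{n\ge0}$ be sequences. (i) If $\{a_n\}$ and $\{A_n\}$ are both even sequences, or both odd sequences, then $$\sum_{k=0}^{2n+1}\binom{2n-\lambda}{2n+1-k}\binom{\lambda}{k}a_{2n+1-k}A_k=0\quad(n=0,1,2,\ldots).$$ (ii) If $\{a_n\}$ is an even sequence and $\{A_n\}$ is an odd sequence, then $$\sum_{k=0}^{2n}\binom{2n-1-\lambda}{2n-k}\binom{\lambda}{k}a_{2n-k}A_k=0\quad(n=0,1,2,\ldots).$$
   Context: A sequence $\{a_n\}_{n\ge0}$ of real (or complex) numbers is called an even sequence if $\sum_{k=0}^n\binom nk(-1)^ka_k=a_n$ for all $n=0,1,2,\ldots$, and an odd sequence if $\sum_{k=0}^n\binom nk(-1)^ka_k=-a_n$ for all $n=0,1,2,\ldots$. For real $x$ and a nonnegative integer $k$, $\binom xk=x(x-1)\cdots(x-k+1)/k!$ (with $\binom x0=1$). -}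

module Defs where

open import Level using (Level)
open import Data.Nat using (ℕ; zero; suc)
open import Data.Nat.Combinatorics using (_C_)
open import Algebra.Bundles using (CommutativeRing)

-- Everything is developed over an arbitrary commutative ring R
-- (the paper works over ℝ or ℂ, which stdlib lacks).
module WithRing {c ℓ : Level} (R : CommutativeRing c ℓ) where
  open CommutativeRing R

  ι : ℕ → Carrier
  ι zero    = 0#
  ι (suc n) = 1# + ι n

  sgn : ℕ → Carrier
  sgn zero    = 1#
  sgn (suc k) = - sgn k

  sumTo : (ℕ → Carrier) → ℕ → Carrier
  sumTo f zero    = f 0
  sumTo f (suc n) = sumTo f n + f (suc n)

  IsEven : (ℕ → Carrier) → Set ℓ
  IsEven a = ∀ n → sumTo (λ k → ι (n C k) * (sgn k * a k)) n ≈ a n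

  IsOdd : (ℕ → Carrier) → Set ℓ
  IsOdd a = ∀ n → sumTo (λ k → ι (n C k) * (sgn k * a k)) n ≈ - a n

  -- Generalized binomial coefficient binom(x,k) = x(x-1)...(x-k+1)/k!,
  -- given inv m playing the role of 1/(m+1).
  gbinom : (inv : ℕ → Carrier) → Carrier → ℕ → Carrier
  gbinom inv x zero    = 1#
  gbinom inv x (suc k) = gbinom inv x k * (x - ι k) * inv k

module Submission where

-- Write M for the upper summation index (M = 2n+1 in (i),
-- M = 2n in (ii)) and put x = (M - 1) - λ in both cases.  By upper
-- negation and trinomial revision of generalized binomial coefficients,
--     binom(x, M-k) · binom(λ, k) = binom(λ, M) · C(M,k) · (-1)^(M-k),
-- so the sum in the theorem equals binom(λ, M) · conv M a A, where
--     conv N a b = Σ_k C(N,k) (-1)^(N-k) a_(N-k) b_k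
-- is the signed binomial convolution.  The key identity is that the
-- binomial transform  (B a)_n = Σ_k C(n,k) (-1)^k a_k  intertwines with it:
--     conv N (B a) (B b) = (-1)^N conv N a b,
-- proved by induction on N from Pascal's rule.  Even/odd sequences are
-- those with B a = a, resp. B a = -a, hence conv M a A = -conv M a A in
-- each case of the theorem, and conv M a A = 0 because 2 is invertible.

open import Defs
open import Level using (Level)
open import Data.Nat as N using (ℕ; zero; suc; _≤_)
open import Data.Nat.Combinatorics
  using (_C_; k>n⇒nCk≡0; nCk+nC[k+1]≡[n+1]C[k+1]; nC1≡n; nCk≡nC[n∸k])
import Data.Nat.Properties as NP
open import Data.Integer as Z using (ℤ; +_; -[1+_]; +[1+_])
import Data.Integer.Properties as ZP
open import Data.Sign as Sign using (Sign)
open import Data.Sum using (_⊎_; inj₁; inj₂)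
open import Data.Product using (_×_; _,_)
open import Data.Maybe using (Maybe; just; nothing)
open import Function using (_∘_)
open import Algebra.Bundles using (CommutativeRing)
open import Relation.Binary.PropositionalEquality as P using (_≡_)
open import Relation.Nullary using (yes; no)
import Algebra.Solver.Ring.AlmostCommutativeRing as ACR
import Algebra.Solver.Ring

-- Absorption identity (k+1)·C(n+1,k+1) = (n+1)·C(n,k), by induction via
-- Pascal's rule.  It turns into the coefficient identity of trinomial
-- revision for generalized binomial coefficients.
absorption : ∀ n k → suc k N.* (suc n C suc k) ≡ suc n N.* (n C k)
absorption zero    zero    = P.refl
absorption zero    (suc k) = NP.*-zeroʳ (suc (suc k))
absorption (suc n) zero    =
  P.trans (NP.*-identityˡ _) (P.trans (nC1≡n (suc (suc n))) (P.sym (NP.*-identityʳ _)))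
absorption (suc n) (suc k) = begin
  suc (suc k) N.* (suc (suc n) C suc (suc k))
    ≡⟨ P.cong (suc (suc k) N.*_) (P.sym (nCk+nC[k+1]≡[n+1]C[k+1] (suc n) (suc k))) ⟩
  suc (suc k) N.* (p N.+ q)
    ≡⟨ solve 3 (λ k p q → (con 2 :+ k) :* (p :+ q) := p :+ (con 1 :+ k) :* p :+ (con 2 :+ k) :* q)
             P.refl k p q ⟩
  p N.+ suc k N.* p N.+ suc (suc k) N.* q
    ≡⟨ P.cong₂ (λ x y → p N.+ x N.+ y) (absorption n k) (absorption n (suc k)) ⟩
  p N.+ suc n N.* (n C k) N.+ suc n N.* (n C suc k)
    ≡⟨ solve 4 (λ p m x y → p :+ m :* x :+ m :* y := p :+ m :* (x :+ y))
             P.refl p (suc n) (n C k) (n C suc k) ⟩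
  p N.+ suc n N.* (n C k N.+ n C suc k)
    ≡⟨ P.cong (λ z → p N.+ suc n N.* z) (nCk+nC[k+1]≡[n+1]C[k+1] n k) ⟩
  suc (suc n) N.* p ∎
  where
  open import Data.Nat.Solver using (module +-*-Solver)
  open +-*-Solver
  open P.≡-Reasoning
  p = suc n C suc k
  q = suc n C suc (suc k)

module InRing {c ℓ : Level} (R : CommutativeRing c ℓ) where
  open CommutativeRing R
  open WithRing R
  open import Relation.Binary.Reasoning.Setoid setoid
  open import Algebra.Properties.Ring ring using (-1*x≈-x)
  open import Algebra.Properties.AbelianGroup +-abelianGroup using (⁻¹-∙-comm)
  open import Algebra.Properties.Group +-group using (⁻¹-involutive; ε⁻¹≈ε)
  open import Algebra.Properties.CommutativeSemigroup *-commutativeSemigroup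
    using (interchange)

  ι-+ : ∀ m n → ι (m N.+ n) ≈ ι m + ι n
  ι-+ zero    n = sym (+-identityˡ _)
  ι-+ (suc m) n = trans (+-congˡ (ι-+ m n)) (sym (+-assoc _ _ _))

  ι-* : ∀ m n → ι (m N.* n) ≈ ι m * ι n
  ι-* zero    n = sym (zeroˡ _)
  ι-* (suc m) n = begin
    ι (n N.+ m N.* n)    ≈⟨ ι-+ n (m N.* n) ⟩
    ι n + ι (m N.* n)    ≈⟨ +-cong (sym (*-identityˡ _)) (ι-* m n) ⟩
    1# * ι n + ι m * ι n ≈⟨ sym (distribʳ _ _ _) ⟩
    (1# + ι m) * ι n     ∎

  ⟦_⟧ℤ : ℤ → Carrier
  ⟦ + n      ⟧ℤ = ι n
  ⟦ -[1+ n ] ⟧ℤ = - ι (suc n)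

  -‿+-distrib : ∀ x y → - (x + y) ≈ - x + - y
  -‿+-distrib x y = sym (⁻¹-∙-comm x y)

  cancel-common : ∀ u x y → (u + x) - (u + y) ≈ x - y
  cancel-common u x y = begin
    (u + x) + - (u + y)   ≈⟨ +-congˡ (-‿+-distrib u y) ⟩
    (u + x) + (- u + - y) ≈⟨ sym (+-assoc _ _ _) ⟩
    ((u + x) + - u) + - y ≈⟨ +-congʳ u+x-u≈x ⟩
    x + - y               ∎
    where
    u+x-u≈x : (u + x) + - u ≈ x
    u+x-u≈x = trans (+-congʳ (+-comm u x))
      (trans (+-assoc _ _ _) (trans (+-congˡ (-‿inverseʳ u)) (+-identityʳ x)))

  ⊖-homo : ∀ m n → ⟦ m Z.⊖ n ⟧ℤ ≈ ι m - ι n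
  ⊖-homo m       zero    = trans (reflexive (P.cong ⟦_⟧ℤ (ZP.⊖-≥ {m} {0} N.z≤n)))
                                 (sym (trans (+-congˡ ε⁻¹≈ε) (+-identityʳ _)))
  ⊖-homo zero    (suc n) = trans (reflexive (P.cong ⟦_⟧ℤ (ZP.⊖-< {0} {suc n} (N.s≤s N.z≤n))))
                                 (sym (+-identityˡ _))
  ⊖-homo (suc m) (suc n) = trans (reflexive (P.cong ⟦_⟧ℤ (ZP.[1+m]⊖[1+n]≡m⊖n m n)))
                                 (trans (⊖-homo m n) (sym (cancel-common 1# (ι m) (ι n))))

  +-homo : ∀ i j → ⟦ i Z.+ j ⟧ℤ ≈ ⟦ i ⟧ℤ + ⟦ j ⟧ℤ
  +-homo -[1+ m ] -[1+ n ] = begin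
    - ι (suc (suc (m N.+ n))) ≈⟨ -‿cong (reflexive (P.cong (λ t → ι (suc t)) (P.sym (NP.+-suc m n)))) ⟩
    - ι (suc m N.+ suc n)     ≈⟨ -‿cong (ι-+ (suc m) (suc n)) ⟩
    - (ι (suc m) + ι (suc n)) ≈⟨ -‿+-distrib _ _ ⟩
    - ι (suc m) + - ι (suc n) ∎
  +-homo -[1+ m ] (+ n)    = trans (⊖-homo n (suc m)) (+-comm _ _)
  +-homo (+ m)    -[1+ n ] = ⊖-homo m (suc n)
  +-homo (+ m)    (+ n)    = ι-+ m n

  ⟦_⟧sign : Sign → Carrier
  ⟦ Sign.+ ⟧sign = 1#
  ⟦ Sign.- ⟧sign = - 1#

  sign-*-homo : ∀ s t → ⟦ s Sign.* t ⟧sign ≈ ⟦ s ⟧sign * ⟦ t ⟧sign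
  sign-*-homo Sign.- Sign.- = sym (trans (-1*x≈-x _) (⁻¹-involutive _))
  sign-*-homo Sign.- Sign.+ = sym (*-identityʳ _)
  sign-*-homo Sign.+ Sign.- = sym (*-identityˡ _)
  sign-*-homo Sign.+ Sign.+ = sym (*-identityˡ _)

  ◃-homo : ∀ s n → ⟦ s Z.◃ n ⟧ℤ ≈ ⟦ s ⟧sign * ι n
  ◃-homo s      zero    = sym (zeroʳ _)
  ◃-homo Sign.- (suc n) = sym (-1*x≈-x _)
  ◃-homo Sign.+ (suc n) = sym (*-identityˡ _)

  sign-magnitude : ∀ i → ⟦ i ⟧ℤ ≈ ⟦ Z.sign i ⟧sign * ι Z.∣ i ∣
  sign-magnitude i = trans (reflexive (P.cong ⟦_⟧ℤ (P.sym (ZP.signᵢ◃∣i∣≡i i))))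
                           (◃-homo (Z.sign i) Z.∣ i ∣)

  *-homo : ∀ i j → ⟦ i Z.* j ⟧ℤ ≈ ⟦ i ⟧ℤ * ⟦ j ⟧ℤ
  *-homo i j = begin
    ⟦ i Z.* j ⟧ℤ
      ≈⟨ ◃-homo (Z.sign i Sign.* Z.sign j) (Z.∣ i ∣ N.* Z.∣ j ∣) ⟩
    ⟦ Z.sign i Sign.* Z.sign j ⟧sign * ι (Z.∣ i ∣ N.* Z.∣ j ∣)
      ≈⟨ *-cong (sign-*-homo (Z.sign i) (Z.sign j)) (ι-* Z.∣ i ∣ Z.∣ j ∣) ⟩
    (⟦ Z.sign i ⟧sign * ⟦ Z.sign j ⟧sign) * (ι Z.∣ i ∣ * ι Z.∣ j ∣)
      ≈⟨ interchange _ _ _ _ ⟩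
    (⟦ Z.sign i ⟧sign * ι Z.∣ i ∣) * (⟦ Z.sign j ⟧sign * ι Z.∣ j ∣)
      ≈⟨ sym (*-cong (sign-magnitude i) (sign-magnitude j)) ⟩
    ⟦ i ⟧ℤ * ⟦ j ⟧ℤ ∎

  -‿homo : ∀ i → ⟦ Z.- i ⟧ℤ ≈ - ⟦ i ⟧ℤ
  -‿homo -[1+ n ]  = sym (⁻¹-involutive _)
  -‿homo (+ zero)  = sym ε⁻¹≈ε
  -‿homo +[1+ n ]  = refl

  ℤ-morphism : Z.+-*-rawRing ACR.-Raw-AlmostCommutative⟶ ACR.fromCommutativeRing R
  ℤ-morphism = record
    { ⟦_⟧ = ⟦_⟧ℤ ; +-homo = +-homo ; *-homo = *-homo ; -‿homo = -‿homo
    ; 0-homo = refl ; 1-homo = +-identityʳ _ }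

  ℤ-coefficient-equality : ∀ i j → Maybe (⟦ i ⟧ℤ ≈ ⟦ j ⟧ℤ)
  ℤ-coefficient-equality i j with i ZP.≟ j
  ... | yes P.refl = just refl
  ... | no _       = nothing

  open Algebra.Solver.Ring Z.+-*-rawRing (ACR.fromCommutativeRing R)
                           ℤ-morphism ℤ-coefficient-equality
    using (solve; _:=_; _:+_; _:*_; _:-_; :-_; _:^_; con; Polynomial)

  -- The polynomial constant 1; it evaluates to 1# on the nose
  -- (whereas con (+ 1) evaluates to 1# + 0#).
  :1 : ∀ {n} → Polynomial n
  :1 = con (+ 0) :^ 0

  sumTo-cong : ∀ {f g : ℕ → Carrier} → (∀ k → f k ≈ g k) → ∀ N → sumTo f N ≈ sumTo g N
  sumTo-cong f≈g zero    = f≈g 0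
  sumTo-cong f≈g (suc N) = +-cong (sumTo-cong f≈g N) (f≈g (suc N))

  sumTo-cong≤ : ∀ {f g : ℕ → Carrier} N → (∀ k → k ≤ N → f k ≈ g k) → sumTo f N ≈ sumTo g N
  sumTo-cong≤ zero    f≈g = f≈g 0 N.z≤n
  sumTo-cong≤ (suc N) f≈g =
    +-cong (sumTo-cong≤ N (λ k k≤N → f≈g k (NP.m≤n⇒m≤1+n k≤N))) (f≈g (suc N) NP.≤-refl)

  sumTo-+ : ∀ (f g : ℕ → Carrier) N → sumTo (λ k → f k + g k) N ≈ sumTo f N + sumTo g N
  sumTo-+ f g zero    = refl
  sumTo-+ f g (suc N) = trans (+-congʳ (sumTo-+ f g N))
    (solve 4 (λ a b c d → (a :+ b) :+ (c :+ d) := (a :+ c) :+ (b :+ d)) refl _ _ _ _)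

  sumTo-neg : ∀ (f : ℕ → Carrier) N → sumTo (λ k → - f k) N ≈ - sumTo f N
  sumTo-neg f zero    = refl
  sumTo-neg f (suc N) = trans (+-congʳ (sumTo-neg f N))
    (solve 2 (λ a b → :- a :+ :- b := :- (a :+ b)) refl _ _)

  sumTo-- : ∀ (f g : ℕ → Carrier) N → sumTo (λ k → f k - g k) N ≈ sumTo f N - sumTo g N
  sumTo-- f g N = trans (sumTo-+ f (λ k → - g k) N) (+-congˡ (sumTo-neg g N))

  sumTo-*ˡ : ∀ u (f : ℕ → Carrier) N → sumTo (λ k → u * f k) N ≈ u * sumTo f N
  sumTo-*ˡ u f zero    = refl
  sumTo-*ˡ u f (suc N) = trans (+-congʳ (sumTo-*ˡ u f N)) (sym (distribˡ u _ _))

  sumTo-shift : ∀ (f : ℕ → Carrier) N → sumTo f (suc N) ≈ f 0 + sumTo (λ k → f (suc k)) N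
  sumTo-shift f zero    = refl
  sumTo-shift f (suc N) = trans (+-congʳ (sumTo-shift f N)) (+-assoc _ _ _)

  sumTo-pascal : ∀ N (f : ℕ → Carrier) →
    sumTo (λ k → ι (suc N C k) * f k) (suc N)
      ≈ sumTo (λ k → ι (N C k) * f k) N + sumTo (λ k → ι (N C k) * f (suc k)) N
  sumTo-pascal N f = begin
    sumTo (λ k → ι (suc N C k) * f k) (suc N)
      ≈⟨ sumTo-shift _ N ⟩
    ι 1 * f 0 + sumTo (λ k → ι (suc N C suc k) * f (suc k)) N
      ≈⟨ +-congˡ (trans (sumTo-cong split N) (sumTo-+ _ _ N)) ⟩
    ι 1 * f 0 + (X + Y)
      ≈⟨ solve 3 (λ u x y → u :+ (x :+ y) := (u :+ y) :+ x) refl _ _ _ ⟩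
    (ι 1 * f 0 + Y) + X
      ≈⟨ +-congʳ (sym (sumTo-shift (λ k → ι (N C k) * f k) N)) ⟩
    (sumTo (λ k → ι (N C k) * f k) N + ι (N C suc N) * f (suc N)) + X
      ≈⟨ +-congʳ (trans (+-congˡ (trans (*-congʳ top-vanishes) (zeroˡ _))) (+-identityʳ _)) ⟩
    sumTo (λ k → ι (N C k) * f k) N + X ∎
    where
    X = sumTo (λ k → ι (N C k) * f (suc k)) N
    Y = sumTo (λ k → ι (N C suc k) * f (suc k)) N
    split : ∀ k → ι (suc N C suc k) * f (suc k)
                    ≈ ι (N C k) * f (suc k) + ι (N C suc k) * f (suc k)
    split k = trans (*-congʳ (trans (reflexive (P.cong ι (P.sym (nCk+nC[k+1]≡[n+1]C[k+1] N k))))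
                                    (ι-+ (N C k) (N C suc k))))
                    (distribʳ _ _ _)
    top-vanishes : ι (N C suc N) ≈ 0#
    top-vanishes = reflexive (P.cong ι (k>n⇒nCk≡0 (NP.n<1+n N)))

  binomialTransform : (ℕ → Carrier) → ℕ → Carrier
  binomialTransform a n = sumTo (λ k → ι (n C k) * (sgn k * a k)) n

  binomialTransform-suc : ∀ (a : ℕ → Carrier) n →
    binomialTransform a (suc n)
      ≈ binomialTransform a n - binomialTransform (λ k → a (suc k)) n
  binomialTransform-suc a n = trans (sumTo-pascal n (λ k → sgn k * a k))
    (+-congˡ (trans (sumTo-cong (λ k → solve 3 (λ u s x → u :* (:- s :* x) := :- (u :* (s :* x)))
                                                 refl _ _ _) n)
                    (sumTo-neg _ n)))

  conv : ℕ → (ℕ → Carrier) → (ℕ → Carrier) → Carrier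
  conv N a b = sumTo (λ k → ι (N C k) * (sgn (N N.∸ k) * (a (N N.∸ k) * b k))) N

  conv-cong : ∀ N {a a′ b b′ : ℕ → Carrier} → (∀ k → a k ≈ a′ k) → (∀ k → b k ≈ b′ k) →
              conv N a b ≈ conv N a′ b′
  conv-cong N a≈a′ b≈b′ = sumTo-cong (λ k → *-congˡ (*-congˡ (*-cong (a≈a′ (N N.∸ k)) (b≈b′ k)))) N

  conv-negˡ : ∀ N (a b : ℕ → Carrier) → conv N (λ k → - a k) b ≈ - conv N a b
  conv-negˡ N a b = trans
    (sumTo-cong (λ k → solve 4 (λ u s x y → u :* (s :* (:- x :* y)) := :- (u :* (s :* (x :* y))))
                             refl _ _ _ _) N)
    (sumTo-neg _ N)

  conv-negʳ : ∀ N (a b : ℕ → Carrier) → conv N a (λ k → - b k) ≈ - conv N a b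
  conv-negʳ N a b = trans
    (sumTo-cong (λ k → solve 4 (λ u s x y → u :* (s :* (x :* :- y)) := :- (u :* (s :* (x :* y))))
                             refl _ _ _ _) N)
    (sumTo-neg _ N)

  conv--ˡ : ∀ N (a a′ b : ℕ → Carrier) →
            conv N (λ k → a k - a′ k) b ≈ conv N a b - conv N a′ b
  conv--ˡ N a a′ b = trans
    (sumTo-cong (λ k → solve 5 (λ u s x x′ y → u :* (s :* ((x :- x′) :* y))
                                  := u :* (s :* (x :* y)) :- u :* (s :* (x′ :* y)))
                             refl _ _ _ _ _) N)
    (sumTo-- _ _ N)

  conv--ʳ : ∀ N (a b b′ : ℕ → Carrier) →
            conv N a (λ k → b k - b′ k) ≈ conv N a b - conv N a b′
  conv--ʳ N a b b′ = trans
    (sumTo-cong (λ k → solve 5 (λ u s x y y′ → u :* (s :* (x :* (y :- y′)))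
                                  := u :* (s :* (x :* y)) :- u :* (s :* (x :* y′)))
                             refl _ _ _ _ _) N)
    (sumTo-- _ _ N)

  conv-suc : ∀ N (a b : ℕ → Carrier) →
    conv (suc N) a b ≈ conv N a (λ k → b (suc k)) - conv N (λ k → a (suc k)) b
  conv-suc N a b = begin
    conv (suc N) a b
      ≈⟨ sumTo-pascal N (λ k → sgn (suc N N.∸ k) * (a (suc N N.∸ k) * b k)) ⟩
    sumTo (λ k → ι (N C k) * term k) N + conv N a (λ k → b (suc k))
      ≈⟨ +-congʳ (trans (sumTo-cong≤ N summand≈) (sumTo-neg _ N)) ⟩
    - conv N (λ k → a (suc k)) b + conv N a (λ k → b (suc k))
      ≈⟨ +-comm _ _ ⟩
    conv N a (λ k → b (suc k)) - conv N (λ k → a (suc k)) b ∎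
    where
    term : ℕ → Carrier
    term k = sgn (suc N N.∸ k) * (a (suc N N.∸ k) * b k)
    -- For k ≤ N one has (N+1) - k = (N - k) + 1, which flips the sign.
    summand≈ : ∀ k → k ≤ N →
      ι (N C k) * term k ≈ - (ι (N C k) * (sgn (N N.∸ k) * (a (suc (N N.∸ k)) * b k)))
    summand≈ k k≤N rewrite NP.+-∸-assoc 1 k≤N =
      solve 3 (λ u s x → u :* (:- s :* x) := :- (u :* (s :* x))) refl _ (sgn (N N.∸ k)) _

  conv-binomialTransform : ∀ N (a b : ℕ → Carrier) →
    conv N (binomialTransform a) (binomialTransform b) ≈ sgn N * conv N a b
  conv-binomialTransform zero a b =
    solve 2 (λ x y → con (+ 1) :* (:1 :* ((con (+ 1) :* (:1 :* x)) :* (con (+ 1) :* (:1 :* y))))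
                  := :1 :* (con (+ 1) :* (:1 :* (x :* y))))
          refl (a 0) (b 0)
  conv-binomialTransform (suc N) a b = begin
    conv (suc N) (B a) (B b)
      ≈⟨ conv-suc N (B a) (B b) ⟩
    conv N (B a) (λ k → B b (suc k)) - conv N (λ k → B a (suc k)) (B b)
      ≈⟨ +-cong (conv-cong N {B a} (λ _ → refl) (binomialTransform-suc b))
                (-‿cong (conv-cong N {b = B b} (binomialTransform-suc a) (λ _ → refl))) ⟩
    conv N (B a) (λ k → B b k - B b′ k) - conv N (λ k → B a k - B a′ k) (B b)
      ≈⟨ +-cong (conv--ʳ N (B a) (B b) (B b′)) (-‿cong (conv--ˡ N (B a) (B a′) (B b))) ⟩
    (conv N (B a) (B b) - conv N (B a) (B b′)) - (conv N (B a) (B b) - conv N (B a′) (B b))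
      ≈⟨ +-cong (+-cong (IH a b) (-‿cong (IH a b′)))
                (-‿cong (+-cong (IH a b) (-‿cong (IH a′ b)))) ⟩
    (s * conv N a b - s * conv N a b′) - (s * conv N a b - s * conv N a′ b)
      ≈⟨ solve 4 (λ s t u v → (s :* t :- s :* u) :- (s :* t :- s :* v) := (:- s) :* (u :- v))
               refl s (conv N a b) (conv N a b′) (conv N a′ b) ⟩
    (- s) * (conv N a b′ - conv N a′ b)
      ≈⟨ *-congˡ (sym (conv-suc N a b)) ⟩
    sgn (suc N) * conv (suc N) a b ∎
    where
    B = binomialTransform
    IH = conv-binomialTransform N
    s = sgn N
    a′ b′ : ℕ → Carrier
    a′ k = a (suc k)
    b′ k = b (suc k)

  conv-same-parity : ∀ {a b : ℕ → Carrier} → (IsEven a × IsEven b) ⊎ (IsOdd a × IsOdd b) →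
                     ∀ N → conv N a b ≈ sgn N * conv N a b
  conv-same-parity {a} {b} (inj₁ (a-even , b-even)) N = begin
    conv N a b                                           ≈⟨ conv-cong N (sym ∘ a-even) (sym ∘ b-even) ⟩
    conv N (binomialTransform a) (binomialTransform b)   ≈⟨ conv-binomialTransform N a b ⟩
    sgn N * conv N a b                                   ∎
  conv-same-parity {a} {b} (inj₂ (a-odd , b-odd)) N = begin
    conv N a b                                         ≈⟨ sym (⁻¹-involutive _) ⟩
    - - conv N a b                                     ≈⟨ -‿cong (sym (conv-negʳ N a b)) ⟩
    - conv N a (λ k → - b k)                           ≈⟨ sym (conv-negˡ N a _) ⟩
    conv N (λ k → - a k) (λ k → - b k)                 ≈⟨ sym (conv-cong N a-odd b-odd) ⟩
    conv N (binomialTransform a) (binomialTransform b) ≈⟨ conv-binomialTransform N a b ⟩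
    sgn N * conv N a b                                 ∎

  conv-mixed-parity : ∀ {a b : ℕ → Carrier} → IsEven a → IsOdd b →
                      ∀ N → - conv N a b ≈ sgn N * conv N a b
  conv-mixed-parity {a} {b} a-even b-odd N = begin
    - conv N a b                                       ≈⟨ sym (conv-negʳ N a b) ⟩
    conv N a (λ k → - b k)                             ≈⟨ sym (conv-cong N a-even b-odd) ⟩
    conv N (binomialTransform a) (binomialTransform b) ≈⟨ conv-binomialTransform N a b ⟩
    sgn N * conv N a b                                 ∎

  module GeneralizedBinomial (inv : ℕ → Carrier) (inv-correct : ∀ m → ι (suc m) * inv m ≈ 1#) where

    binom : Carrier → ℕ → Carrier
    binom = gbinom inv

    binom-cong : ∀ {x y} k → x ≈ y → binom x k ≈ binom y k
    binom-cong zero    x≈y = refl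
    binom-cong (suc k) x≈y = *-congʳ (*-cong (binom-cong k x≈y) (+-congʳ x≈y))

    binom-suc : ∀ v j → binom v (suc j) ≈ v * binom (v - 1#) j * inv j
    binom-suc v zero    = solve 2 (λ v i → :1 :* (v :- con (+ 0)) :* i := v :* :1 :* i) refl v (inv 0)
    binom-suc v (suc j) = trans (*-congʳ (*-congʳ (binom-suc v j)))
      (solve 5 (λ v g i ij i′ → (v :* g :* i) :* (v :- (:1 :+ ij)) :* i′
                                 := v :* (g :* ((v :- :1) :- ij) :* i) :* i′)
             refl v (binom (v - 1#) j) (inv j) (ι j) (inv (suc j)))

    binom-negate : ∀ v j → binom v j ≈ sgn j * binom ((ι j - 1#) - v) j
    binom-negate v zero    = sym (*-identityˡ _)
    binom-negate v (suc j) = begin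
      binom v j * (v - ι j) * inv j
        ≈⟨ *-congʳ (*-congʳ (binom-negate v j)) ⟩
      (sgn j * binom w j) * (v - ι j) * inv j
        ≈⟨ solve 5 (λ s g v ij i → (s :* g) :* (v :- ij) :* i
                                    := (:- s) :* ((((:1 :+ ij) :- :1) :- v) :* g :* i))
                 refl (sgn j) (binom w j) v (ι j) (inv j) ⟩
      (- sgn j) * (w′ * binom w j * inv j)
        ≈⟨ *-congˡ (*-congʳ (*-congˡ (binom-cong j w≈w′-1))) ⟩
      (- sgn j) * (w′ * binom (w′ - 1#) j * inv j)
        ≈⟨ *-congˡ (sym (binom-suc w′ j)) ⟩
      (- sgn j) * binom w′ (suc j) ∎
      where
      w  = (ι j - 1#) - v
      w′ = (ι (suc j) - 1#) - v
      w≈w′-1 : w ≈ w′ - 1#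
      w≈w′-1 = solve 2 (λ v ij → (ij :- :1) :- v := ((:1 :+ ij) :- :1) :- v :- :1) refl v (ι j)

    absorption-inv : ∀ j k → ι (suc (j N.+ k) C suc j) * inv (j N.+ k) ≈ ι ((j N.+ k) C j) * inv j
    absorption-inv j k = begin
      c₁ * i
        ≈⟨ sym (*-identityʳ _) ⟩
      c₁ * i * 1#
        ≈⟨ *-congˡ (sym (inv-correct j)) ⟩
      c₁ * i * (ι (suc j) * inv j)
        ≈⟨ solve 4 (λ c i s ij → c :* i :* (s :* ij) := (s :* c) :* (i :* ij))
                 refl c₁ i (ι (suc j)) (inv j) ⟩
      (ι (suc j) * c₁) * (i * inv j)
        ≈⟨ *-congʳ (trans (sym (ι-* (suc j) (suc (j N.+ k) C suc j)))
                   (trans (reflexive (P.cong ι (absorption (j N.+ k) j)))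
                          (ι-* (suc (j N.+ k)) ((j N.+ k) C j)))) ⟩
      (ι (suc (j N.+ k)) * c₀) * (i * inv j)
        ≈⟨ solve 4 (λ s c i ij → (s :* c) :* (i :* ij) := c :* ij :* (s :* i))
                 refl (ι (suc (j N.+ k))) c₀ i (inv j) ⟩
      c₀ * inv j * (ι (suc (j N.+ k)) * i)
        ≈⟨ trans (*-congˡ (inv-correct (j N.+ k))) (*-identityʳ _) ⟩
      c₀ * inv j ∎
      where
      c₁ = ι (suc (j N.+ k) C suc j)
      c₀ = ι ((j N.+ k) C j)
      i  = inv (j N.+ k)

    binom-revision : ∀ lam k j → binom lam k * binom (lam - ι k) j ≈ ι ((j N.+ k) C j) * binom lam (j N.+ k)
    binom-revision lam k zero    = solve 1 (λ g → g :* :1 := con (+ 1) :* g) refl (binom lam k)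
    binom-revision lam k (suc j) = begin
      binom lam k * (binom (lam - ι k) j * ((lam - ι k) - ι j) * inv j)
        ≈⟨ solve 6 (λ a b l ik ij i → a :* (b :* ((l :- ik) :- ij) :* i) := (a :* b) :* ((l :- ik) :- ij) :* i)
                 refl (binom lam k) (binom (lam - ι k) j) lam (ι k) (ι j) (inv j) ⟩
      (binom lam k * binom (lam - ι k) j) * ((lam - ι k) - ι j) * inv j
        ≈⟨ *-congʳ (*-congʳ (binom-revision lam k j)) ⟩
      (c₀ * g) * ((lam - ι k) - ι j) * inv j
        ≈⟨ solve 6 (λ c g l ik ij i → (c :* g) :* ((l :- ik) :- ij) :* i := (c :* i) :* g :* (l :- (ij :+ ik)))
                 refl c₀ g lam (ι k) (ι j) (inv j) ⟩
      (c₀ * inv j) * g * (lam - (ι j + ι k))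
        ≈⟨ *-congʳ (*-congʳ (sym (absorption-inv j k))) ⟩
      (c₁ * inv (j N.+ k)) * g * (lam - (ι j + ι k))
        ≈⟨ solve 6 (λ c i g l ij ik → (c :* i) :* g :* (l :- (ij :+ ik)) := c :* (g :* (l :- (ij :+ ik)) :* i))
                 refl c₁ (inv (j N.+ k)) g lam (ι j) (ι k) ⟩
      c₁ * (g * (lam - (ι j + ι k)) * inv (j N.+ k))
        ≈⟨ *-congˡ (*-congʳ (*-congˡ (+-congˡ (-‿cong (sym (ι-+ j k)))))) ⟩
      c₁ * (g * (lam - ι (j N.+ k)) * inv (j N.+ k)) ∎
      where
      c₁ = ι (suc (j N.+ k) C suc j)
      c₀ = ι ((j N.+ k) C j)
      g  = binom lam (j N.+ k)

    -- Upper negation turns binom(x, N-k) into ±binom(λ-k, N-k); then revise.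
    binom-product : ∀ x lam N k → k ≤ N → x ≈ (ι N - 1#) - lam →
      binom x (N N.∸ k) * binom lam k ≈ binom lam N * (ι (N C k) * sgn (N N.∸ k))
    binom-product x lam N k k≤N x≈ = begin
      binom x j * binom lam k
        ≈⟨ *-congʳ (trans (binom-negate x j) (*-congˡ (binom-cong j negated≈))) ⟩
      (sgn j * binom (lam - ι k) j) * binom lam k
        ≈⟨ solve 3 (λ s a b → (s :* a) :* b := s :* (b :* a)) refl (sgn j) _ (binom lam k) ⟩
      sgn j * (binom lam k * binom (lam - ι k) j)
        ≈⟨ *-congˡ (binom-revision lam k j) ⟩
      sgn j * (ι ((j N.+ k) C j) * binom lam (j N.+ k))
        ≈⟨ *-congˡ (*-cong (reflexive (P.cong ι (P.trans (P.cong (_C j) j+k≡N) (P.sym (nCk≡nC[n∸k] k≤N)))))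
                           (reflexive (P.cong (binom lam) j+k≡N))) ⟩
      sgn j * (ι (N C k) * binom lam N)
        ≈⟨ solve 3 (λ s c g → s :* (c :* g) := g :* (c :* s)) refl (sgn j) (ι (N C k)) (binom lam N) ⟩
      binom lam N * (ι (N C k) * sgn j) ∎
      where
      j = N N.∸ k
      j+k≡N : j N.+ k ≡ N
      j+k≡N = NP.m∸n+n≡m k≤N
      negated≈ : (ι j - 1#) - x ≈ lam - ι k
      negated≈ = begin
        (ι j - 1#) - x
          ≈⟨ +-congˡ (-‿cong (trans x≈ (+-congʳ (+-congʳ
               (trans (reflexive (P.cong ι (P.sym j+k≡N))) (ι-+ j k)))))) ⟩
        (ι j - 1#) - ((ι j + ι k - 1#) - lam)
          ≈⟨ solve 3 (λ a b l → (a :- :1) :- ((a :+ b :- :1) :- l) := l :- b) refl (ι j) (ι k) lam ⟩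
        lam - ι k ∎

    sum≈binom*conv : ∀ x lam M (a b : ℕ → Carrier) → x ≈ (ι M - 1#) - lam →
      sumTo (λ k → binom x (M N.∸ k) * (binom lam k * (a (M N.∸ k) * b k))) M ≈ binom lam M * conv M a b
    sum≈binom*conv x lam M a b x≈ = trans (sumTo-cong≤ M summand≈) (sumTo-*ˡ (binom lam M) _ M)
      where
      summand≈ : ∀ k → k ≤ M →
        binom x (M N.∸ k) * (binom lam k * (a (M N.∸ k) * b k))
          ≈ binom lam M * (ι (M C k) * (sgn (M N.∸ k) * (a (M N.∸ k) * b k)))
      summand≈ k k≤M = begin
        binom x (M N.∸ k) * (binom lam k * r)
          ≈⟨ sym (*-assoc _ _ _) ⟩
        (binom x (M N.∸ k) * binom lam k) * r
          ≈⟨ *-congʳ (binom-product x lam M k k≤M x≈) ⟩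
        (binom lam M * (ι (M C k) * sgn (M N.∸ k))) * r
          ≈⟨ solve 4 (λ g c s r → (g :* (c :* s)) :* r := g :* (c :* (s :* r)))
                   refl (binom lam M) (ι (M C k)) (sgn (M N.∸ k)) r ⟩
        binom lam M * (ι (M C k) * (sgn (M N.∸ k) * r)) ∎
        where r = a (M N.∸ k) * b k

    -- 2 is invertible, so an element equal to its own negative is zero.
    self-negating⇒0 : ∀ t → t ≈ - t → t ≈ 0#
    self-negating⇒0 t t≈-t = begin
      t                   ≈⟨ sym (*-identityˡ t) ⟩
      1# * t              ≈⟨ *-congʳ (sym (inv-correct 1)) ⟩
      (ι 2 * inv 1) * t   ≈⟨ solve 2 (λ i t → (con (+ 2) :* i) :* t := i :* (t :+ t)) refl (inv 1) t ⟩
      inv 1 * (t + t)     ≈⟨ *-congˡ (+-congˡ t≈-t) ⟩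
      inv 1 * (t + - t)   ≈⟨ solve 2 (λ i t → i :* (t :- t) := con (+ 0)) refl (inv 1) t ⟩
      0#                  ∎

    sum-vanishes : ∀ {x} lam M {a b : ℕ → Carrier} → x ≈ (ι M - 1#) - lam → conv M a b ≈ - conv M a b →
      sumTo (λ k → binom x (M N.∸ k) * (binom lam k * (a (M N.∸ k) * b k))) M ≈ 0#
    sum-vanishes {x} lam M {a} {b} x≈ conv≈-conv = begin
      sumTo (λ k → binom x (M N.∸ k) * (binom lam k * (a (M N.∸ k) * b k))) M
        ≈⟨ sum≈binom*conv x lam M a b x≈ ⟩
      binom lam M * conv M a b ≈⟨ *-congˡ (self-negating⇒0 _ conv≈-conv) ⟩
      binom lam M * 0#         ≈⟨ zeroʳ _ ⟩
      0#                       ∎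

  sgn-even-* : ∀ n t → sgn (2 N.* n) * t ≈ t
  sgn-even-* zero    t = *-identityˡ t
  sgn-even-* (suc n) t = begin
    sgn (2 N.* suc n) * t   ≈⟨ *-congʳ (reflexive (P.cong sgn (NP.*-suc 2 n))) ⟩
    - - sgn (2 N.* n) * t   ≈⟨ *-congʳ (⁻¹-involutive _) ⟩
    sgn (2 N.* n) * t       ≈⟨ sgn-even-* n t ⟩
    t                       ∎

  sgn-odd-* : ∀ n t → sgn (2 N.* n N.+ 1) * t ≈ - t
  sgn-odd-* n t = begin
    sgn (2 N.* n N.+ 1) * t   ≈⟨ *-congʳ (reflexive (P.cong sgn (NP.+-comm (2 N.* n) 1))) ⟩
    - sgn (2 N.* n) * t       ≈⟨ solve 2 (λ s t → :- s :* t := :- (s :* t)) refl (sgn (2 N.* n)) t ⟩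
    - (sgn (2 N.* n) * t)     ≈⟨ -‿cong (sgn-even-* n t) ⟩
    - t                       ∎

  upper-shift : ∀ m lam → ι m - lam ≈ (ι (m N.+ 1) - 1#) - lam
  upper-shift m lam = trans (solve 2 (λ x l → x :- l := ((x :+ con (+ 1)) :- :1) :- l) refl (ι m) lam)
                            (+-congʳ (+-congʳ (sym (ι-+ m 1))))

theorem2p7 : {c ℓ : Level} (R : CommutativeRing c ℓ) →
    let open CommutativeRing R
        open WithRing R
    in (inv : ℕ → Carrier) → (∀ m → ι (suc m) * inv m ≈ 1#) →
       (lam : Carrier) (a A : ℕ → Carrier) →
       (((IsEven a × IsEven A) ⊎ (IsOdd a × IsOdd A)) →
          ∀ n → sumTo (λ k → gbinom inv (ι (2 N.* n) - lam) ((2 N.* n N.+ 1) N.∸ k)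
                              * (gbinom inv lam k * (a ((2 N.* n N.+ 1) N.∸ k) * A k)))
                      (2 N.* n N.+ 1) ≈ 0#)
       × ((IsEven a × IsOdd A) →
          ∀ n → sumTo (λ k → gbinom inv ((ι (2 N.* n) - 1#) - lam) ((2 N.* n) N.∸ k)
                              * (gbinom inv lam k * (a ((2 N.* n) N.∸ k) * A k)))
                      (2 N.* n) ≈ 0#)
theorem2p7 R inv inv-correct lam a A = part-i , part-ii
  where
  open CommutativeRing R using (refl; sym; trans)
  open InRing R
  open GeneralizedBinomial inv inv-correct
  part-i = λ parity n →
    sum-vanishes lam (2 N.* n N.+ 1) {a} {A} (upper-shift (2 N.* n) lam)
      (trans (conv-same-parity parity (2 N.* n N.+ 1)) (sgn-odd-* n _))
  part-ii = λ { (a-even , A-odd) n →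
    sum-vanishes lam (2 N.* n) {a} {A} refl
      (sym (trans (conv-mixed-parity a-even A-odd (2 N.* n)) (sgn-even-* n _))) }
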